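{- Let $a$ be a weak composition of length $n$ and let $k$ be the index of the last nonzero entry of $a$. Then the monomial slide polynomial $\mathfrak{M}_a$ is quasisymmetric in $x_1,\dots,x_k$ if and only if $a$ is quasi-flat. Moreover, in this case $\mathfrak{M}_a=M_{\mathrm{flat}(a)}(x_1,\dots,x_k)$.
   Context: A weak composition of length $n$ is a sequence $a=(a_1,\dots,a_n)$ of nonnegative integers; $\mathrm{flat}(a)$ is the composition obtained by deleting its zero entries. For weak compositions $a,b$ of length $n$, $b$ dominates $a$, written $b\ge a$, if $b_1+\dots+b_i\ge a_1+\dots+a_i$ for all $i=1,\dots,n$. The monomial slide polynomial is $\mathfrak{M}_a=\sum x_1^{b_1}\cdots x_n^{b_n}$, summed over weak compositions $b$ of length $n$ with $b\ge a$ and $\mathrm{flat}(b)=\mathrm{flat}(a)$. A weak composition is quasi-flat if its nonzero entries occupy a set of consecutive positions. A polynomial $f\in\mathbb{Z}[x_1,\dots,x_k]$ is quasisymmetric if for every composition $(\alpha_1,\dots,\alpha_\ell)$ the coefficient of $x_{i_1}^{\alpha_1}\cdots x_{i_\ell}^{\alpha_\ell}$ in $f$ is the same for all $1\le i_1<\dots<i_\ell\le k$. For a composition $\alpha$ of length $\ell$, $M_\alpha(x_1,\dots,x_k)=\sum_{1\le i_1<\dots<i_\ell\le k}x_{i_1}^{\alpha_1}\cdots x_{i_\ell}^{\alpha_\ell}$. -}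

module Defs where

open import Data.Nat using (ℕ; zero; suc; _+_; _≤_; _<_; _≤?_; _≟_)
open import Data.Integer using (ℤ; +_)
open import Data.Fin using (Fin; toℕ)
open import Data.Vec using (Vec; lookup; toList; tabulate)
import Data.Vec.Properties as VecP
import Data.List.Properties as ListP
open import Data.List using (List; []; _∷_; _++_; _∷ʳ_; map; filter; length; take; upTo)
open import Data.Nat.ListAction using (sum)
open import Data.List.Relation.Unary.All using (All; all?)
open import Data.Bool using (if_then_else_)
open import Relation.Nullary using (¬_; does; ¬?)
open import Relation.Nullary.Decidable using (_×-dec_)
open import Relation.Binary.PropositionalEquality using (_≡_; _≢_)
open import Data.Product using (_×_)

WeakComp : ℕ → Set
WeakComp n = Vec ℕ n

-- A polynomial in ℤ[x_1,…,x_n], given by its coefficient function: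
-- the coefficient of the monomial x^b for each exponent vector b.
Poly : ℕ → Set
Poly n = Vec ℕ n → ℤ

flat : ∀ {n} → WeakComp n → List ℕ
flat a = filter (λ x → ¬? (x ≟ 0)) (toList a)

IsComposition : List ℕ → Set
IsComposition α = All (λ x → 0 < x) α

psum : ∀ {n} → ℕ → WeakComp n → ℕ
psum i a = sum (take i (toList a))

Dominates : ∀ {n} → WeakComp n → WeakComp n → Set
Dominates {n} b a = All (λ i → psum i a ≤ psum i b) (map suc (upTo n))

dominates? : ∀ {n} (b a : WeakComp n) → Relation.Nullary.Dec (Dominates b a)
dominates? {n} b a = all? (λ i → psum i a ≤? psum i b) (map suc (upTo n))

-- Monomial slide polynomial 𝔐_a = Σ_{b ≥ a, flat b = flat a} x^b.
-- Each such b occurs exactly once, so the coefficient of x^b is 1 or 0.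
slide : ∀ {n} → WeakComp n → Poly n
slide a b =
  if does (dominates? b a ×-dec ListP.≡-dec _≟_ (flat b) (flat a))
  then + 1 else + 0

-- incs ℓ m : all strictly increasing lists of length ℓ with entries in
-- {0,…,m-1} (0-based positions; position p stands for the variable x_{p+1}).
incs : ℕ → ℕ → List (List ℕ)
incs zero m = [] ∷ []
incs (suc ℓ) zero = []
incs (suc ℓ) (suc m) = incs (suc ℓ) m ++ map (_∷ʳ m) (incs ℓ m)

expAt : ℕ → List ℕ → List ℕ → ℕ
expAt p [] _ = 0
expAt p (_ ∷ _) [] = 0
expAt p (i ∷ is) (x ∷ xs) = (if does (i ≟ p) then x else 0) + expAt p is xs

expVec : ∀ {n} → List ℕ → List ℕ → Vec ℕ n
expVec is α = tabulate (λ p → expAt (toℕ p) is α)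

QuasiSymIn : ∀ {n} → ℕ → Poly n → Set
QuasiSymIn k f =
  ∀ (α : List ℕ) → IsComposition α →
  ∀ (is js : List ℕ) →
  is Data.List.Membership.Propositional.∈ incs (length α) k →
  js Data.List.Membership.Propositional.∈ incs (length α) k →
  f (expVec is α) ≡ f (expVec js α)
  where import Data.List.Membership.Propositional

-- M_α(x_1,…,x_k) = Σ_{1 ≤ i_1 < … < i_ℓ ≤ k} x_{i_1}^{α_1}⋯x_{i_ℓ}^{α_ℓ},
-- as a polynomial in n variables: coefficient of x^b is the number of
-- index sequences whose monomial is x^b.
monoQSym : ∀ {n} → ℕ → List ℕ → Poly n
monoQSym k α b =
  + length (filter (λ is → VecP.≡-dec _≟_ (expVec is α) b) (incs (length α) k))

QuasiFlat : ∀ {n} → WeakComp n → Set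
QuasiFlat {n} a =
  ∀ (i j p : Fin n) → toℕ i ≤ toℕ p → toℕ p ≤ toℕ j →
  lookup a i ≢ 0 → lookup a j ≢ 0 → lookup a p ≢ 0

-- A weak composition b is determined by flat b and its support, the increasing list of positions
-- of its nonzero entries, and psum c b is the total weight of the entries of flat b whose position
-- lies below c. So for flat b = flat a, b dominates a as soon as each support position of b is at
-- most the corresponding one of a. If a is quasi-flat its support is the interval ending at k, which
-- bounds every increasing sequence in [0, k] in this way: every monomial of M_flat(a) occurs in the
-- slide polynomial with coefficient 1, and conversely dominance at c = k + 1 keeps the support of any
-- monomial of the slide polynomial inside [0, k]. If instead a has a gap p between two nonzero
-- entries, moving the last support position below p up to p gives an increasing sequence in [0, k]
-- with a smaller partial sum at p; its monomial is missing from the slide polynomial although x^a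
-- occurs, so quasisymmetry fails.

module Submission where

open import Defs
open import Data.Nat using (ℕ; zero; suc; _+_; _≤_; _<_; _<?_; _≟_; z≤n; s≤s)
open import Data.Nat.Properties
open import Algebra.Properties.CommutativeSemigroup +-commutativeSemigroup using (x∙yz≈y∙xz)
import Data.Integer as ℤ
open import Data.Fin using (Fin; toℕ; fromℕ<)
import Data.Fin as Fin
open import Data.Fin.Properties using (toℕ-fromℕ<)
open import Data.Vec using (lookup; toList; tabulate)
import Data.Vec.Properties as VecP
open import Data.List using (List; []; _∷_; [_]; _∷ʳ_; map; filter; length; take)
import Data.List.Properties as ListP
open import Data.Nat.ListAction using (sum)
open import Data.Nat.ListAction.Properties using (sum-++)
open import Data.List.Relation.Unary.All as All using (All; []; _∷_)
import Data.List.Relation.Unary.All.Properties as AllP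
open import Data.List.Relation.Unary.Any using (here; there)
open import Data.List.Relation.Unary.AllPairs using (AllPairs; []; _∷_)
import Data.List.Relation.Unary.AllPairs.Properties as AllPairsP
open import Data.List.Relation.Binary.Pointwise using (Pointwise; []; _∷_)
open import Data.List.Membership.Propositional using (_∈_; _∉_)
import Data.List.Membership.Propositional.Properties as MemP
open import Data.List.Membership.DecPropositional _≟_ using (_∈?_)
open import Data.List.Relation.Unary.Unique.Propositional using (Unique)
import Data.List.Relation.Unary.Unique.Propositional.Properties as UniqueP
open import Data.Bool using (Bool; true; false; if_then_else_)
open import Relation.Nullary using (¬_; does; ¬?; Dec; yes; no; contradiction)
open import Relation.Nullary.Decidable using (dec-true; dec-false; _×-dec_)
open import Relation.Binary using (tri<; tri≈; tri>)
open import Relation.Binary.PropositionalEquality using (_≡_; _≢_; refl; sym; trans; cong; cong₂; subst; subst₂; module ≡-Reasoning)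
open import Data.Product using (_×_; _,_; proj₁; proj₂; ∃)
import Data.Product as Product
open import Data.Sum using (_⊎_; inj₁; inj₂)
open import Data.Unit using (⊤; tt)
open import Function using (_∘_)
open import Function.Bundles using (_⇔_; mk⇔; Equivalence)

open Equivalence using (to; from)

Increasing : List ℕ → Set
Increasing = AllPairs _<_

increasing-head≤ : ∀ {y x ys} → Increasing (y ∷ ys) → x ∈ y ∷ ys → y ≤ x
increasing-head≤ _ (here refl) = ≤-refl
increasing-head≤ (y<ys ∷ _) (there x∈) = <⇒≤ (All.lookup y<ys x∈)

All<⇒∉ : ∀ {p is} → All (p <_) is → p ∉ is
All<⇒∉ p<is p∈is = n≮n _ (All.lookup p<is p∈is)

if-then-0≤ : ∀ (b : Bool) x → (if b then x else 0) ≤ x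
if-then-0≤ true x = ≤-refl
if-then-0≤ false x = z≤n

if-does-mono : ∀ {P Q : Set} x (p? : Dec P) (q? : Dec Q) → (P → Q) →
               (if does p? then x else 0) ≤ (if does q? then x else 0)
if-does-mono x (yes _) (yes _) _ = ≤-refl
if-does-mono x (yes p) (no ¬q) p⇒q = contradiction (p⇒q p) ¬q
if-does-mono x (no _) (yes _) _ = z≤n
if-does-mono x (no _) (no _) _ = ≤-refl

if-does≡1⇔ : ∀ {P : Set} (p? : Dec P) → (if does p? then ℤ.+ 1 else ℤ.+ 0) ≡ ℤ.+ 1 ⇔ P
if-does≡1⇔ (yes p) = mk⇔ (λ _ → p) (λ _ → refl)
if-does≡1⇔ (no ¬p) = mk⇔ (λ ()) (λ p → contradiction p ¬p)

if-does≡0 : ∀ {P : Set} (p? : Dec P) → ¬ P → (if does p? then ℤ.+ 1 else ℤ.+ 0) ≡ ℤ.+ 0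
if-does≡0 (yes p) ¬p = contradiction p ¬p
if-does≡0 (no _) _ = refl

module _ {A : Set} {P : A → Set} (P? : ∀ x → Dec (P x)) where

  length-filter-none : ∀ xs → (∀ {y} → y ∈ xs → ¬ P y) → length (filter P? xs) ≡ 0
  length-filter-none xs ¬P = cong length (ListP.filter-none P? (All.tabulate ¬P))

  length-filter-unique : ∀ xs {x} → Unique xs → x ∈ xs → P x → (∀ {y} → y ∈ xs → P y → y ≡ x) →
                         length (filter P? xs) ≡ 1
  length-filter-unique (y ∷ ys) (y∉ys ∷ _) (here refl) Py only
    rewrite ListP.filter-accept P? {xs = ys} Py =
      cong suc (length-filter-none ys (λ z∈ Pz → All.lookup y∉ys z∈ (sym (only (there z∈) Pz))))
  length-filter-unique (y ∷ ys) (y∉ys ∷ u) (there x∈) Px only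
    rewrite ListP.filter-reject P? {xs = ys}
              (λ Py → All.lookup y∉ys (subst (_∈ ys) (sym (only (here refl) Py)) x∈) refl)
    = length-filter-unique ys u x∈ Px (only ∘ there)

-- Exponent vectors

exponent : List ℕ → List ℕ → ℕ → ℕ
exponent is α p = expAt p is α

expAt-here : ∀ p is x α → expAt p (p ∷ is) (x ∷ α) ≡ x + expAt p is α
expAt-here p is x α rewrite dec-true (p ≟ p) refl = refl

expAt-there : ∀ {p i} is x α → p ≢ i → expAt p (i ∷ is) (x ∷ α) ≡ expAt p is α
expAt-there {p} {i} is x α p≢i rewrite dec-false (i ≟ p) (p≢i ∘ sym) = refl

expAt-∉ : ∀ {p} is α → p ∉ is → expAt p is α ≡ 0
expAt-∉ [] α _ = refl
expAt-∉ (i ∷ is) [] _ = refl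
expAt-∉ (i ∷ is) (x ∷ α) p∉ = trans (expAt-there is x α (p∉ ∘ here)) (expAt-∉ is α (p∉ ∘ there))

expAt-∈ : ∀ {p} is α → p ∈ is → IsComposition α → length is ≡ length α → 0 < expAt p is α
expAt-∈ {p} (.p ∷ is) (x ∷ α) (here refl) (0<x ∷ _) _ rewrite expAt-here p is x α = ≤-trans 0<x (m≤m+n x _)
expAt-∈ (i ∷ is) (x ∷ α) (there p∈) (_ ∷ pos) len =
  ≤-trans (expAt-∈ is α p∈ pos (suc-injective len)) (m≤n+m _ _)

expAt≢0⇒∈ : ∀ {p} is α → expAt p is α ≢ 0 → p ∈ is
expAt≢0⇒∈ {p} is α e≢0 with p ∈? is
... | yes p∈ = p∈
... | no p∉ = contradiction (expAt-∉ is α p∉) e≢0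

applyFrom : {A : Set} → (ℕ → A) → ℕ → ℕ → List A
applyFrom f s zero = []
applyFrom f s (suc m) = f s ∷ applyFrom f (suc s) m

applyFrom-cong : ∀ {A : Set} {f g : ℕ → A} s m → (∀ {p} → s ≤ p → f p ≡ g p) →
                 applyFrom f s m ≡ applyFrom g s m
applyFrom-cong s zero f≗g = refl
applyFrom-cong s (suc m) f≗g = cong₂ _∷_ (f≗g ≤-refl) (applyFrom-cong (suc s) m (f≗g ∘ <⇒≤))

applyFrom-∷ʳ : ∀ {A : Set} (f : ℕ → A) s c → applyFrom f s (suc c) ≡ applyFrom f s c ∷ʳ f (s + c)
applyFrom-∷ʳ f s zero = cong (λ z → [ f z ]) (sym (+-identityʳ s))
applyFrom-∷ʳ f s (suc c) =
  cong (f s ∷_) (trans (applyFrom-∷ʳ f (suc s) c) (cong (λ z → applyFrom f (suc s) c ∷ʳ f z) (sym (+-suc s c))))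

take-applyFrom : ∀ {A : Set} (f : ℕ → A) s {c m} → c ≤ m → take c (applyFrom f s m) ≡ applyFrom f s c
take-applyFrom f s {zero} _ = refl
take-applyFrom f s {suc c} (s≤s c≤m) = cong (f s ∷_) (take-applyFrom f (suc s) c≤m)

toList-tabulate : ∀ {A : Set} n (h : Fin n → A) (f : ℕ → A) s → (∀ p → h p ≡ f (s + toℕ p)) →
                  toList (tabulate h) ≡ applyFrom f s n
toList-tabulate zero h f s h≗f = refl
toList-tabulate (suc n) h f s h≗f =
  cong₂ _∷_ (trans (h≗f Fin.zero) (cong f (+-identityʳ s)))
    (toList-tabulate n (h ∘ Fin.suc) f (suc s) (λ p → trans (h≗f (Fin.suc p)) (cong f (+-suc s (toℕ p)))))

toList-expVec : ∀ n is α → toList (expVec {n} is α) ≡ applyFrom (exponent is α) 0 n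
toList-expVec n is α = toList-tabulate n _ (exponent is α) 0 (λ _ → refl)

lookup-expVec : ∀ {n} is α (q : Fin n) → lookup (expVec is α) q ≡ expAt (toℕ q) is α
lookup-expVec is α q = VecP.lookup∘tabulate _ q

-- Support of a weak composition

dropZeros : List ℕ → List ℕ
dropZeros = filter (λ x → ¬? (x ≟ 0))

supportFrom : ℕ → List ℕ → List ℕ
supportFrom s [] = []
supportFrom s (zero ∷ L) = supportFrom (suc s) L
supportFrom s (suc x ∷ L) = s ∷ supportFrom (suc s) L

support : ∀ {n} → WeakComp n → List ℕ
support a = supportFrom 0 (toList a)

dropZeros-positive : ∀ L → IsComposition (dropZeros L)
dropZeros-positive L = All.map n≢0⇒n>0 (AllP.all-filter (λ x → ¬? (x ≟ 0)) L)

supportFrom-≥ : ∀ s L → All (s ≤_) (supportFrom s L)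
supportFrom-≥ s [] = []
supportFrom-≥ s (zero ∷ L) = All.map <⇒≤ (supportFrom-≥ (suc s) L)
supportFrom-≥ s (suc x ∷ L) = ≤-refl ∷ All.map <⇒≤ (supportFrom-≥ (suc s) L)

supportFrom-increasing : ∀ s L → Increasing (supportFrom s L)
supportFrom-increasing s [] = []
supportFrom-increasing s (zero ∷ L) = supportFrom-increasing (suc s) L
supportFrom-increasing s (suc x ∷ L) = supportFrom-≥ (suc s) L ∷ supportFrom-increasing (suc s) L

supportFrom-< : ∀ s L → All (_< s + length L) (supportFrom s L)
supportFrom-< s [] = []
supportFrom-< s (zero ∷ L) =
  subst (λ b → All (_< b) (supportFrom (suc s) L)) (sym (+-suc s (length L))) (supportFrom-< (suc s) L)
supportFrom-< s (suc x ∷ L) =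
  subst (λ b → All (_< b) (s ∷ supportFrom (suc s) L)) (sym (+-suc s (length L)))
    (s≤s (m≤m+n s _) ∷ supportFrom-< (suc s) L)

length-supportFrom : ∀ s L → length (supportFrom s L) ≡ length (dropZeros L)
length-supportFrom s [] = refl
length-supportFrom s (zero ∷ L) = length-supportFrom (suc s) L
length-supportFrom s (suc x ∷ L) = cong suc (length-supportFrom (suc s) L)

applyFrom-absent : ∀ {s} m is α → All (s <_) is →
                   applyFrom (exponent is α) s (suc m) ≡ 0 ∷ applyFrom (exponent is α) (suc s) m
applyFrom-absent {s} m is α s<is = cong (_∷ applyFrom (exponent is α) (suc s) m) (expAt-∉ is α (All<⇒∉ s<is))

applyFrom-present : ∀ {s} m is x α → All (s <_) is →
                    applyFrom (exponent (s ∷ is) (x ∷ α)) s (suc m) ≡ x ∷ applyFrom (exponent is α) (suc s) m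
applyFrom-present {s} m is x α s<is = cong₂ _∷_ head tail
  where
  head : expAt s (s ∷ is) (x ∷ α) ≡ x
  head = trans (expAt-here s is x α) (trans (cong (x +_) (expAt-∉ is α (All<⇒∉ s<is))) (+-identityʳ x))
  tail : applyFrom (exponent (s ∷ is) (x ∷ α)) (suc s) m ≡ applyFrom (exponent is α) (suc s) m
  tail = applyFrom-cong (suc s) m (λ s<p → expAt-there is x α (>⇒≢ s<p))

applyFrom-supportFrom : ∀ s L → applyFrom (exponent (supportFrom s L) (dropZeros L)) s (length L) ≡ L
applyFrom-supportFrom s [] = refl
applyFrom-supportFrom s (zero ∷ L) =
  trans (applyFrom-absent (length L) _ _ (supportFrom-≥ (suc s) L)) (cong (0 ∷_) (applyFrom-supportFrom (suc s) L))
applyFrom-supportFrom s (suc x ∷ L) =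
  trans (applyFrom-present (length L) _ (suc x) _ (supportFrom-≥ (suc s) L))
        (cong (suc x ∷_) (applyFrom-supportFrom (suc s) L))

Decodes : ℕ → List ℕ → List ℕ → List ℕ → Set
Decodes s L is α = dropZeros L ≡ α × supportFrom s L ≡ is

applyFrom-exponent-decodes : ∀ s m is α → Increasing is → All (s ≤_) is → All (_< s + m) is →
  IsComposition α → length is ≡ length α → Decodes s (applyFrom (exponent is α) s m) is α
applyFrom-exponent-decodes s zero [] [] _ _ _ _ _ = refl , refl
applyFrom-exponent-decodes s zero [] (_ ∷ _) _ _ _ _ ()
applyFrom-exponent-decodes s zero (i ∷ is) α _ (s≤i ∷ _) (i<s+0 ∷ _) _ _ =
  contradiction (subst (i <_) (+-identityʳ s) i<s+0) (≤⇒≯ s≤i)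
applyFrom-exponent-decodes s (suc m) [] [] _ _ _ _ _ = applyFrom-exponent-decodes (suc s) m [] [] [] [] [] [] refl
applyFrom-exponent-decodes s (suc m) [] (_ ∷ _) _ _ _ _ ()
applyFrom-exponent-decodes s (suc m) (i ∷ is) [] _ _ _ _ ()
applyFrom-exponent-decodes s (suc m) (i ∷ is) (zero ∷ α) _ _ _ (() ∷ _) _
applyFrom-exponent-decodes s (suc m) (i ∷ is) (suc x ∷ α) (i<is ∷ inc) (s≤i ∷ _) i∷is<s+m (_ ∷ pos) len
  with i ≟ s
... | yes refl =
  subst (λ L → Decodes s L (s ∷ is) (suc x ∷ α)) (sym (applyFrom-present m is (suc x) α i<is))
    (Product.map (cong (suc x ∷_)) (cong (s ∷_))
      (applyFrom-exponent-decodes (suc s) m is α inc i<is (shift is (All.tail i∷is<s+m)) pos (suc-injective len)))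
  where
  shift : ∀ js → All (_< s + suc m) js → All (_< suc s + m) js
  shift js = subst (λ b → All (_< b) js) (+-suc s m)
... | no i≢s =
  subst (λ L → Decodes s L (i ∷ is) (suc x ∷ α)) (sym (applyFrom-absent m (i ∷ is) (suc x ∷ α) s<i∷is))
    (applyFrom-exponent-decodes (suc s) m (i ∷ is) (suc x ∷ α) (i<is ∷ inc) s<i∷is
      (shift (i ∷ is) i∷is<s+m) (s≤s z≤n ∷ pos) len)
  where
  shift : ∀ js → All (_< s + suc m) js → All (_< suc s + m) js
  shift js = subst (λ b → All (_< b) js) (+-suc s m)
  s<i : s < i
  s<i = ≤∧≢⇒< s≤i (i≢s ∘ sym)
  s<i∷is : All (s <_) (i ∷ is)
  s<i∷is = s<i ∷ All.map (<-trans s<i) i<is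

support-increasing : ∀ {n} (b : WeakComp n) → Increasing (support b)
support-increasing b = supportFrom-increasing 0 (toList b)

support-< : ∀ {n} (b : WeakComp n) → All (_< n) (support b)
support-< b = subst (λ m → All (_< m) (support b)) (VecP.length-toList b) (supportFrom-< 0 (toList b))

length-support : ∀ {n} (b : WeakComp n) → length (support b) ≡ length (flat b)
length-support b = length-supportFrom 0 (toList b)

flat-positive : ∀ {n} (b : WeakComp n) → IsComposition (flat b)
flat-positive b = dropZeros-positive (toList b)

expVec-support : ∀ {n} (b : WeakComp n) → expVec (support b) (flat b) ≡ b
expVec-support {n} b = trans (sym (VecP.cast-is-id refl _)) (VecP.toList-injective refl _ b (begin
  toList (expVec (support b) (flat b))                 ≡⟨ toList-expVec n (support b) (flat b) ⟩
  applyFrom (exponent (support b) (flat b)) 0 n        ≡⟨ cong (applyFrom _ 0) (VecP.length-toList b) ⟨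
  applyFrom (exponent (support b) (flat b)) 0 (length (toList b)) ≡⟨ applyFrom-supportFrom 0 (toList b) ⟩
  toList b                                             ∎))
  where open ≡-Reasoning

module _ {n is α} (inc : Increasing is) (is<n : All (_< n) is) (pos : IsComposition α)
         (len : length is ≡ length α) where

  private
    decodes : Decodes 0 (toList (expVec {n} is α)) is α
    decodes = subst (λ L → Decodes 0 L is α) (sym (toList-expVec n is α))
      (applyFrom-exponent-decodes 0 n is α inc (All.map (λ _ → z≤n) is<n) is<n pos len)

  flat-expVec : flat (expVec {n} is α) ≡ α
  flat-expVec = proj₁ decodes

  support-expVec : support (expVec {n} is α) ≡ is
  support-expVec = proj₂ decodes

lookup≢0⇔∈support : ∀ {n} (b : WeakComp n) (q : Fin n) → lookup b q ≢ 0 ⇔ toℕ q ∈ support b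
lookup≢0⇔∈support b q = mk⇔
  (λ bq≢0 → expAt≢0⇒∈ (support b) (flat b) (bq≢0 ∘ trans lookup-b))
  (λ q∈ → n>0⇒n≢0 (subst (0 <_) (sym lookup-b)
     (expAt-∈ (support b) (flat b) q∈ (flat-positive b) (length-support b))))
  where
  lookup-b : lookup b q ≡ expAt (toℕ q) (support b) (flat b)
  lookup-b = trans (cong (λ v → lookup v q) (sym (expVec-support b))) (lookup-expVec (support b) (flat b) q)

lookup≢0⇔∈support′ : ∀ {n} (b : WeakComp n) {q} (q<n : q < n) → lookup b (fromℕ< q<n) ≢ 0 ⇔ q ∈ support b
lookup≢0⇔∈support′ b q<n =
  subst (λ p → lookup b (fromℕ< q<n) ≢ 0 ⇔ p ∈ support b) (toℕ-fromℕ< q<n) (lookup≢0⇔∈support b (fromℕ< q<n))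

support-≤ : ∀ {n} (b : WeakComp n) (k : Fin n) → (∀ j → toℕ k < toℕ j → lookup b j ≡ 0) →
            All (_≤ toℕ k) (support b)
support-≤ b k after = All.tabulate λ {j} j∈ → ≮⇒≥ λ k<j →
  let j<n = All.lookup (support-< b) j∈ in
  from (lookup≢0⇔∈support′ b j<n) j∈ (after (fromℕ< j<n) (subst (toℕ k <_) (sym (toℕ-fromℕ< j<n)) k<j))

Convex : List ℕ → Set
Convex xs = ∀ {x y q} → x ∈ xs → y ∈ xs → x ≤ q → q ≤ y → q ∈ xs

quasiFlat⇔convex : ∀ {n} (b : WeakComp n) → QuasiFlat b ⇔ Convex (support b)
quasiFlat⇔convex b = mk⇔ quasiFlat⇒convex convex⇒quasiFlat
  where
  quasiFlat⇒convex : QuasiFlat b → Convex (support b)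
  quasiFlat⇒convex qf {x} {y} {q} x∈ y∈ x≤q q≤y =
    to (lookup≢0⇔∈support′ b q<n)
      (qf (fromℕ< x<n) (fromℕ< y<n) (fromℕ< q<n)
        (subst₂ _≤_ (sym (toℕ-fromℕ< x<n)) (sym (toℕ-fromℕ< q<n)) x≤q)
        (subst₂ _≤_ (sym (toℕ-fromℕ< q<n)) (sym (toℕ-fromℕ< y<n)) q≤y)
        (from (lookup≢0⇔∈support′ b x<n) x∈) (from (lookup≢0⇔∈support′ b y<n) y∈))
    where
    x<n = All.lookup (support-< b) x∈
    y<n = All.lookup (support-< b) y∈
    q<n = ≤-<-trans q≤y y<n
  convex⇒quasiFlat : Convex (support b) → QuasiFlat b
  convex⇒quasiFlat cvx i j p i≤p p≤j bi≢0 bj≢0 =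
    from (lookup≢0⇔∈support b p)
      (cvx (to (lookup≢0⇔∈support b i) bi≢0) (to (lookup≢0⇔∈support b j) bj≢0) i≤p p≤j)

-- Partial sums

weightBelow : ℕ → List ℕ → List ℕ → ℕ
weightBelow c [] _ = 0
weightBelow c (_ ∷ _) [] = 0
weightBelow c (i ∷ is) (x ∷ α) = (if does (i <? c) then x else 0) + weightBelow c is α

weightBelow-< : ∀ {c i} is x α → i < c → weightBelow c (i ∷ is) (x ∷ α) ≡ x + weightBelow c is α
weightBelow-< {c} {i} is x α i<c rewrite dec-true (i <? c) i<c = refl

weightBelow-≥ : ∀ {c i} is x α → c ≤ i → weightBelow c (i ∷ is) (x ∷ α) ≡ weightBelow c is α
weightBelow-≥ {c} {i} is x α c≤i rewrite dec-false (i <? c) (≤⇒≯ c≤i) = refl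

weightBelow-zero : ∀ is α → weightBelow 0 is α ≡ 0
weightBelow-zero [] α = refl
weightBelow-zero (i ∷ is) [] = refl
weightBelow-zero (i ∷ is) (x ∷ α) = trans (weightBelow-≥ {0} {i} is x α z≤n) (weightBelow-zero is α)

weightBelow-suc : ∀ c is α → weightBelow (suc c) is α ≡ weightBelow c is α + expAt c is α
weightBelow-suc c [] α = refl
weightBelow-suc c (i ∷ is) [] = refl
weightBelow-suc c (i ∷ is) (x ∷ α) with <-cmp i c
... | tri< i<c _ _ = begin
  weightBelow (suc c) (i ∷ is) (x ∷ α)   ≡⟨ weightBelow-< is x α (m<n⇒m<1+n i<c) ⟩
  x + weightBelow (suc c) is α           ≡⟨ cong (x +_) (weightBelow-suc c is α) ⟩
  x + (weightBelow c is α + expAt c is α) ≡⟨ +-assoc x _ _ ⟨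
  x + weightBelow c is α + expAt c is α
    ≡⟨ cong₂ _+_ (weightBelow-< is x α i<c) (expAt-there is x α (>⇒≢ i<c)) ⟨
  weightBelow c (i ∷ is) (x ∷ α) + expAt c (i ∷ is) (x ∷ α) ∎
  where open ≡-Reasoning
... | tri≈ _ refl _ = begin
  weightBelow (suc i) (i ∷ is) (x ∷ α)   ≡⟨ weightBelow-< is x α (n<1+n i) ⟩
  x + weightBelow (suc i) is α           ≡⟨ cong (x +_) (weightBelow-suc i is α) ⟩
  x + (weightBelow i is α + expAt i is α) ≡⟨ x∙yz≈y∙xz x (weightBelow i is α) (expAt i is α) ⟩
  weightBelow i is α + (x + expAt i is α) ≡⟨ cong₂ _+_ (weightBelow-≥ is x α ≤-refl) (expAt-here i is x α) ⟨
  weightBelow i (i ∷ is) (x ∷ α) + expAt i (i ∷ is) (x ∷ α) ∎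
  where open ≡-Reasoning
... | tri> _ _ c<i = begin
  weightBelow (suc c) (i ∷ is) (x ∷ α)   ≡⟨ weightBelow-≥ is x α c<i ⟩
  weightBelow (suc c) is α               ≡⟨ weightBelow-suc c is α ⟩
  weightBelow c is α + expAt c is α
    ≡⟨ cong₂ _+_ (weightBelow-≥ is x α (<⇒≤ c<i)) (expAt-there is x α (<⇒≢ c<i)) ⟨
  weightBelow c (i ∷ is) (x ∷ α) + expAt c (i ∷ is) (x ∷ α) ∎
  where open ≡-Reasoning

sum-applyFrom-exponent : ∀ is α c → sum (applyFrom (exponent is α) 0 c) ≡ weightBelow c is α
sum-applyFrom-exponent is α zero = sym (weightBelow-zero is α)
sum-applyFrom-exponent is α (suc c) = begin
  sum (applyFrom f 0 (suc c))                 ≡⟨ cong sum (applyFrom-∷ʳ f 0 c) ⟩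
  sum (applyFrom f 0 c ∷ʳ expAt c is α)        ≡⟨ sum-++ (applyFrom f 0 c) [ expAt c is α ] ⟩
  sum (applyFrom f 0 c) + (expAt c is α + 0)   ≡⟨ cong₂ _+_ (sum-applyFrom-exponent is α c) (+-identityʳ _) ⟩
  weightBelow c is α + expAt c is α            ≡⟨ weightBelow-suc c is α ⟨
  weightBelow (suc c) is α                     ∎
  where
  open ≡-Reasoning
  f = exponent is α

psum-expVec : ∀ {n} is α {c} → c ≤ n → psum c (expVec {n} is α) ≡ weightBelow c is α
psum-expVec {n} is α {c} c≤n = begin
  sum (take c (toList (expVec {n} is α)))        ≡⟨ cong (sum ∘ take c) (toList-expVec n is α) ⟩
  sum (take c (applyFrom (exponent is α) 0 n))   ≡⟨ cong sum (take-applyFrom (exponent is α) 0 c≤n) ⟩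
  sum (applyFrom (exponent is α) 0 c)            ≡⟨ sum-applyFrom-exponent is α c ⟩
  weightBelow c is α                             ∎
  where open ≡-Reasoning

psum-support : ∀ {n} (b : WeakComp n) {c} → c ≤ n → psum c b ≡ weightBelow c (support b) (flat b)
psum-support b {c} c≤n = trans (cong (psum c) (sym (expVec-support b))) (psum-expVec (support b) (flat b) c≤n)

weightBelow≤sum : ∀ c is α → weightBelow c is α ≤ sum α
weightBelow≤sum c [] α = z≤n
weightBelow≤sum c (i ∷ is) [] = z≤n
weightBelow≤sum c (i ∷ is) (x ∷ α) = +-mono-≤ (if-then-0≤ (does (i <? c)) x) (weightBelow≤sum c is α)

weightBelow-all< : ∀ {c} is α → All (_< c) is → length is ≡ length α → weightBelow c is α ≡ sum α
weightBelow-all< [] [] _ _ = refl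
weightBelow-all< (i ∷ is) (x ∷ α) (i<c ∷ is<c) len =
  trans (weightBelow-< is x α i<c) (cong (x +_) (weightBelow-all< is α is<c (suc-injective len)))

sum≤weightBelow⇒all< : ∀ {c} is α → IsComposition α → length is ≡ length α →
                      sum α ≤ weightBelow c is α → All (_< c) is
sum≤weightBelow⇒all< [] α _ _ _ = []
sum≤weightBelow⇒all< {c} (i ∷ is) (x ∷ α) (0<x ∷ pos) len sum≤ with i <? c
... | yes i<c = i<c ∷ sum≤weightBelow⇒all< is α pos (suc-injective len)
                        (+-cancelˡ-≤ x _ _ (subst (x + sum α ≤_) (weightBelow-< is x α i<c) sum≤))
... | no i≮c = contradiction (begin
  x + sum α                      ≤⟨ sum≤ ⟩
  weightBelow c (i ∷ is) (x ∷ α) ≡⟨ weightBelow-≥ is x α (≮⇒≥ i≮c) ⟩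
  weightBelow c is α             ≤⟨ weightBelow≤sum c is α ⟩
  sum α                          ∎) (<⇒≱ (m<n+m (sum α) 0<x))
  where open ≤-Reasoning

weightBelow-antitone : ∀ c {is js} α → Pointwise _≤_ is js → weightBelow c js α ≤ weightBelow c is α
weightBelow-antitone c α [] = z≤n
weightBelow-antitone c [] (_ ∷ _) = z≤n
weightBelow-antitone c (x ∷ α) (_∷_ {i} {j} i≤j is≤js) =
  +-mono-≤ (if-does-mono x (j <? c) (i <? c) (≤-<-trans i≤j)) (weightBelow-antitone c α is≤js)

-- Dominance and the slide coefficient

dominates⇔ : ∀ {n} (b a : WeakComp n) → Dominates b a ⇔ (∀ {c} → c ≤ n → psum c a ≤ psum c b)
dominates⇔ {n} b a = mk⇔
  (λ { dom {zero} _ → z≤n ; dom {suc c} c<n → All.lookup dom (MemP.∈-map⁺ suc (MemP.∈-upTo⁺ c<n)) })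
  (λ psum≤ → All.tabulate λ c∈ → let c′ , c′∈ , c≡ = MemP.∈-map⁻ suc c∈ in
     subst (λ c → psum c a ≤ psum c b) (sym c≡) (psum≤ (MemP.∈-upTo⁻ c′∈)))

dominates-expVec⇔ : ∀ {n} (a : WeakComp n) is →
  Dominates (expVec is (flat a)) a ⇔
  (∀ {c} → c ≤ n → weightBelow c (support a) (flat a) ≤ weightBelow c is (flat a))
dominates-expVec⇔ a is = mk⇔
  (λ dom {c} c≤n →
     subst₂ _≤_ (psum-support a c≤n) (psum-expVec is (flat a) c≤n) (to (dominates⇔ _ a) dom c≤n))
  (λ wb≤ → from (dominates⇔ _ a) λ {c} c≤n →
     subst₂ _≤_ (sym (psum-support a c≤n)) (sym (psum-expVec is (flat a) c≤n)) (wb≤ c≤n))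

slide≡1⇔ : ∀ {n} (a b : WeakComp n) → slide a b ≡ ℤ.+ 1 ⇔ (Dominates b a × flat b ≡ flat a)
slide≡1⇔ a b = if-does≡1⇔ (dominates? b a ×-dec ListP.≡-dec _≟_ (flat b) (flat a))

slide≡0 : ∀ {n} (a b : WeakComp n) → ¬ (Dominates b a × flat b ≡ flat a) → slide a b ≡ ℤ.+ 0
slide≡0 a b = if-does≡0 (dominates? b a ×-dec ListP.≡-dec _≟_ (flat b) (flat a))

slide-refl : ∀ {n} (a : WeakComp n) → slide a a ≡ ℤ.+ 1
slide-refl a = from (slide≡1⇔ a a) (from (dominates⇔ a a) (λ _ → ≤-refl) , refl)

slide≡0-flat≢ : ∀ {n} (a : WeakComp n) {is β} → Increasing is → All (_< n) is → IsComposition β →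
                length is ≡ length β → β ≢ flat a → slide a (expVec is β) ≡ ℤ.+ 0
slide≡0-flat≢ a inc is<n pos len β≢ = slide≡0 a _ (β≢ ∘ trans (sym (flat-expVec inc is<n pos len)) ∘ proj₂)

-- Increasing index sequences

increasing-∷ʳ : ∀ {m} ys → Increasing ys → All (_< m) ys → Increasing (ys ∷ʳ m)
increasing-∷ʳ ys inc ys<m = AllPairsP.++⁺ inc ([] ∷ []) (All.map (_∷ []) ys<m)

length-∷ʳ : ∀ (ys : List ℕ) m → length (ys ∷ʳ m) ≡ suc (length ys)
length-∷ʳ ys m = trans (ListP.length-++ ys) (+-comm (length ys) 1)

increasing-split : ∀ {m} xs → Increasing xs → All (_< suc m) xs →
  All (_< m) xs ⊎ ∃ λ ys → xs ≡ ys ∷ʳ m × Increasing ys × All (_< m) ys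
increasing-split [] _ _ = inj₁ []
increasing-split {m} (x ∷ xs) (x<xs ∷ inc) (x<1+m ∷ xs<1+m) with increasing-split xs inc xs<1+m
... | inj₂ (ys , refl , inc′ , ys<m) =
  inj₂ (x ∷ ys , refl , proj₁ (AllP.∷ʳ⁻ x<xs) ∷ inc′ , proj₂ (AllP.∷ʳ⁻ x<xs) ∷ ys<m)
... | inj₁ xs<m with x <? m
...   | yes x<m = inj₁ (x<m ∷ xs<m)
...   | no x≮m with ≤-antisym (≤-pred x<1+m) (≮⇒≥ x≮m)
increasing-split (x ∷ []) _ _ | inj₁ _ | no _ | refl = inj₂ ([] , refl , [] , [])
increasing-split (x ∷ y ∷ ys) ((x<y ∷ _) ∷ _) _ | inj₁ (y<x ∷ _) | no _ | refl =
  contradiction (<-trans x<y y<x) (n≮n x)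

∈-incs⁻ : ∀ {ℓ m xs} → xs ∈ incs ℓ m → length xs ≡ ℓ × Increasing xs × All (_< m) xs
∈-incs⁻ {zero} (here refl) = refl , [] , []
∈-incs⁻ {suc ℓ} {suc m} xs∈ with MemP.∈-++⁻ (incs (suc ℓ) m) xs∈
... | inj₁ xs∈′ = Product.map₂ (Product.map₂ (All.map m<n⇒m<1+n)) (∈-incs⁻ xs∈′)
... | inj₂ xs∈′ with MemP.∈-map⁻ (_∷ʳ m) xs∈′
...   | ys , ys∈ , refl with ∈-incs⁻ ys∈
...     | len , inc , ys<m =
  trans (length-∷ʳ ys m) (cong suc len) , increasing-∷ʳ ys inc ys<m , AllP.∷ʳ⁺ (All.map m<n⇒m<1+n ys<m) (n<1+n m)

∈-incs⁺ : ∀ {ℓ m xs} → length xs ≡ ℓ → Increasing xs → All (_< m) xs → xs ∈ incs ℓ m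
∈-incs⁺ {zero} {xs = []} refl _ _ = here refl
∈-incs⁺ {suc ℓ} {zero} {x ∷ xs} _ _ (() ∷ _)
∈-incs⁺ {suc ℓ} {suc m} {xs} len inc xs<1+m with increasing-split xs inc xs<1+m
... | inj₁ xs<m = MemP.∈-++⁺ˡ (∈-incs⁺ len inc xs<m)
... | inj₂ (ys , refl , inc′ , ys<m) =
  MemP.∈-++⁺ʳ (incs (suc ℓ) m)
    (MemP.∈-map⁺ (_∷ʳ m) (∈-incs⁺ (suc-injective (trans (sym (length-∷ʳ ys m)) len)) inc′ ys<m))

incs-unique : ∀ ℓ m → Unique (incs ℓ m)
incs-unique zero m = [] ∷ []
incs-unique (suc ℓ) zero = []
incs-unique (suc ℓ) (suc m) =
  UniqueP.++⁺ (incs-unique (suc ℓ) m)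
    (UniqueP.map⁺ (λ {x} {y} → ListP.∷ʳ-injectiveˡ x y) (incs-unique ℓ m)) disjoint
  where
  disjoint : ∀ {v} → ¬ (v ∈ incs (suc ℓ) m × v ∈ map (_∷ʳ m) (incs ℓ m))
  disjoint (v∈ , v∈′) with MemP.∈-map⁻ (_∷ʳ m) v∈′
  ... | ys , _ , refl = n≮n m (proj₂ (AllP.∷ʳ⁻ (proj₂ (proj₂ (∈-incs⁻ {suc ℓ} v∈)))))

head+length< : ∀ {m i} is → Increasing (i ∷ is) → All (_< m) (i ∷ is) → i + length is < m
head+length< {m} {i} [] _ (i<m ∷ []) = subst (_< m) (sym (+-identityʳ i)) i<m
head+length< {m} {i} (j ∷ js) ((i<j ∷ _) ∷ inc) (_ ∷ j∷js<m) = begin-strict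
  i + suc (length js) ≡⟨ +-suc i (length js) ⟩
  suc i + length js   ≤⟨ +-monoˡ-≤ (length js) i<j ⟩
  j + length js       <⟨ head+length< js inc j∷js<m ⟩
  m                   ∎
  where open ≤-Reasoning

-- js = m ∸ length js , … , m ∸ 1
TopInterval : ℕ → List ℕ → Set
TopInterval m [] = ⊤
TopInterval m (j ∷ js) = suc (j + length js) ≡ m × TopInterval m js

increasing≤topInterval : ∀ {m} is js → Increasing is → All (_< m) is → TopInterval m js →
                         length is ≡ length js → Pointwise _≤_ is js
increasing≤topInterval [] [] _ _ _ _ = []
increasing≤topInterval {m} (i ∷ is) (j ∷ js) inc@(_ ∷ inc′) is<m (top , top′) len =
  i≤j ∷ increasing≤topInterval is js inc′ (All.tail is<m) top′ (suc-injective len)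
  where
  i≤j : i ≤ j
  i≤j = +-cancelʳ-≤ (length js) i j (≤-pred (begin-strict
    i + length js ≡⟨ cong (i +_) (suc-injective len) ⟨
    i + length is <⟨ head+length< is inc is<m ⟩
    m             ≡⟨ top ⟨
    suc (j + length js) ∎))
    where open ≤-Reasoning

convex-tail : ∀ {j js} → Increasing (j ∷ js) → Convex (j ∷ js) → Convex js
convex-tail (j<js ∷ _) cvx x∈ y∈ x≤q q≤y with cvx (there x∈) (there y∈) x≤q q≤y
... | here refl = contradiction x≤q (<⇒≱ (All.lookup j<js x∈))
... | there q∈ = q∈

convex⇒topInterval : ∀ {K} js → Increasing js → All (_≤ K) js → K ∈ js → Convex js → TopInterval (suc K) js
convex⇒topInterval (j ∷ []) _ _ (here refl) _ = cong suc (+-identityʳ j) , tt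
convex⇒topInterval {K} (j ∷ y ∷ ys) inc@((j<y ∷ _) ∷ inc′) (_ ∷ y∷ys≤K) K∈ cvx =
  trans (cong suc step) (proj₁ rest) , rest
  where
  y≡1+j : y ≡ suc j
  y≡1+j with cvx (here refl) (there (here refl)) (n≤1+n j) j<y
  ... | here 1+j≡j = contradiction 1+j≡j (>⇒≢ (n<1+n j))
  ... | there 1+j∈ = ≤-antisym (increasing-head≤ inc′ 1+j∈) j<y
  K∈tail : K ∈ j ∷ y ∷ ys → K ∈ y ∷ ys
  K∈tail (here refl) = contradiction (All.head y∷ys≤K) (<⇒≱ j<y)
  K∈tail (there K∈′) = K∈′
  rest = convex⇒topInterval (y ∷ ys) inc′ y∷ys≤K (K∈tail K∈) (convex-tail inc cvx)
  step : j + suc (length ys) ≡ y + length ys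
  step = trans (+-suc j (length ys)) (cong (_+ length ys) (sym y≡1+j))

-- raiseTo p x xs : the list x ∷ xs with its last entry below p replaced by p
raiseTo : ℕ → ℕ → List ℕ → List ℕ
raiseTo p x [] = p ∷ []
raiseTo p x (x′ ∷ xs) with x′ <? p
... | yes _ = x ∷ raiseTo p x′ xs
... | no _ = p ∷ x′ ∷ xs

length-raiseTo : ∀ p x xs → length (raiseTo p x xs) ≡ length (x ∷ xs)
length-raiseTo p x [] = refl
length-raiseTo p x (x′ ∷ xs) with x′ <? p
... | yes _ = cong suc (length-raiseTo p x′ xs)
... | no _ = refl

All-raiseTo : ∀ {P : ℕ → Set} {p} x xs → All P (x ∷ xs) → P p → All P (raiseTo p x xs)
All-raiseTo x [] _ Pp = Pp ∷ []
All-raiseTo {p = p} x (x′ ∷ xs) (Px ∷ Pxs) Pp with x′ <? p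
... | yes _ = Px ∷ All-raiseTo x′ xs Pxs Pp
... | no _ = Pp ∷ Pxs

raiseTo-increasing : ∀ {p} x xs → Increasing (x ∷ xs) → p ∉ x ∷ xs → Increasing (raiseTo p x xs)
raiseTo-increasing x [] _ _ = [] ∷ []
raiseTo-increasing {p} x (x′ ∷ xs) ((x<x′ ∷ x<xs) ∷ inc@(x′<xs ∷ _)) p∉ with x′ <? p
... | yes x′<p =
  All-raiseTo x′ xs (x<x′ ∷ x<xs) (<-trans x<x′ x′<p) ∷ raiseTo-increasing x′ xs inc (p∉ ∘ there)
... | no x′≮p = (p<x′ ∷ All.map (<-trans p<x′) x′<xs) ∷ inc
  where
  p<x′ : p < x′
  p<x′ = ≤∧≢⇒< (≮⇒≥ x′≮p) (p∉ ∘ there ∘ here)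

weightBelow-replace< : ∀ {p x} xs y α → x < p → 0 < y →
                       weightBelow p (p ∷ xs) (y ∷ α) < weightBelow p (x ∷ xs) (y ∷ α)
weightBelow-replace< {p} {x} xs y α x<p 0<y = begin-strict
  weightBelow p (p ∷ xs) (y ∷ α) ≡⟨ weightBelow-≥ xs y α ≤-refl ⟩
  weightBelow p xs α              <⟨ m<n+m _ 0<y ⟩
  y + weightBelow p xs α          ≡⟨ weightBelow-< xs y α x<p ⟨
  weightBelow p (x ∷ xs) (y ∷ α)  ∎
  where open ≤-Reasoning

raiseTo-lighter : ∀ {p} x xs α → x < p → IsComposition α → length (x ∷ xs) ≡ length α →
                  weightBelow p (raiseTo p x xs) α < weightBelow p (x ∷ xs) α
raiseTo-lighter x [] (y ∷ α) x<p (0<y ∷ _) _ = weightBelow-replace< [] y α x<p 0<y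
raiseTo-lighter {p} x (x′ ∷ xs) (y ∷ α) x<p (0<y ∷ pos) len with x′ <? p
... | yes x′<p = +-monoʳ-< _ (raiseTo-lighter x′ xs α x′<p pos (suc-injective len))
... | no _ = weightBelow-replace< (x′ ∷ xs) y α x<p 0<y

gap⇒lighter : ∀ {m p x} xs α → Increasing xs → All (_< m) xs → x ∈ xs → x < p → p < m → p ∉ xs →
  IsComposition α → length xs ≡ length α →
  ∃ λ ys → ys ∈ incs (length α) m × weightBelow p ys α < weightBelow p xs α
gap⇒lighter {p = p} (x₀ ∷ xs) α inc x₀∷xs<m x∈ x<p p<m p∉ pos len =
  raiseTo p x₀ xs ,
  ∈-incs⁺ (trans (length-raiseTo p x₀ xs) len) (raiseTo-increasing x₀ xs inc p∉)
          (All-raiseTo x₀ xs x₀∷xs<m p<m) ,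
  raiseTo-lighter x₀ xs α (≤-<-trans (increasing-head≤ inc x∈) x<p) pos len

-- Quasi-flat weak compositions

module _ {n} (a : WeakComp n) {K} (K∈ : K ∈ support a) (≤K : All (_≤ K) (support a)) where

  private
    K<n : K < n
    K<n = All.lookup (support-< a) K∈
    <1+K : All (_< suc K) (support a)
    <1+K = All.map s≤s ≤K
    <1+K⇒<n : ∀ {i} → i < suc K → i < n
    <1+K⇒<n i<1+K = ≤-<-trans (≤-pred i<1+K) K<n
    expVec≟ : ∀ b is → Dec (expVec {n} is (flat a) ≡ b)
    expVec≟ b is = VecP.≡-dec _≟_ (expVec is (flat a)) b

  convex⇒slide≡1 : Convex (support a) → ∀ {is} → is ∈ incs (length (flat a)) (suc K) →
                   slide a (expVec is (flat a)) ≡ ℤ.+ 1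
  convex⇒slide≡1 cvx {is} is∈ with ∈-incs⁻ is∈
  ... | len , inc , is<1+K =
    from (slide≡1⇔ a _) (dominates , flat-expVec inc (All.map <1+K⇒<n is<1+K) (flat-positive a) len)
    where
    is≤support : Pointwise _≤_ is (support a)
    is≤support = increasing≤topInterval is (support a) inc is<1+K
      (convex⇒topInterval (support a) (support-increasing a) ≤K K∈ cvx) (trans len (sym (length-support a)))
    dominates : Dominates (expVec is (flat a)) a
    dominates = from (dominates-expVec⇔ a is) (λ _ → weightBelow-antitone _ (flat a) is≤support)

  convex⇒quasiSym : Convex (support a) → QuasiSymIn (suc K) (slide a)
  convex⇒quasiSym cvx β pos is js is∈ js∈ with ListP.≡-dec _≟_ β (flat a)
  ... | yes refl = trans (convex⇒slide≡1 cvx is∈) (sym (convex⇒slide≡1 cvx js∈))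
  ... | no β≢ = trans (wrongFlat is∈) (sym (wrongFlat js∈))
    where
    wrongFlat : ∀ {xs} → xs ∈ incs (length β) (suc K) → slide a (expVec xs β) ≡ ℤ.+ 0
    wrongFlat xs∈ with ∈-incs⁻ xs∈
    ... | len , inc , xs<1+K = slide≡0-flat≢ a inc (All.map <1+K⇒<n xs<1+K) pos len β≢

  quasiSym⇒convex : QuasiSymIn (suc K) (slide a) → Convex (support a)
  quasiSym⇒convex qs {x} {y} {q} x∈ y∈ x≤q q≤y with q ∈? support a
  ... | yes q∈ = q∈
  ... | no q∉ = contradiction heavier (<⇒≱ lighter)
    where
    x<q : x < q
    x<q = ≤∧≢⇒< x≤q (λ x≡q → q∉ (subst (_∈ support a) x≡q x∈))
    q<1+K : q < suc K
    q<1+K = s≤s (≤-trans q≤y (All.lookup ≤K y∈))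
    gap = gap⇒lighter (support a) (flat a) (support-increasing a) <1+K x∈ x<q q<1+K q∉
            (flat-positive a) (length-support a)
    ys = proj₁ gap
    lighter = proj₂ (proj₂ gap)
    slide≡1 : slide a (expVec ys (flat a)) ≡ ℤ.+ 1
    slide≡1 = begin
      slide a (expVec ys (flat a))          ≡⟨ qs (flat a) (flat-positive a) ys (support a) (proj₁ (proj₂ gap))
                                                 (∈-incs⁺ (length-support a) (support-increasing a) <1+K) ⟩
      slide a (expVec (support a) (flat a)) ≡⟨ cong (slide a) (expVec-support a) ⟩
      slide a a                             ≡⟨ slide-refl a ⟩
      ℤ.+ 1                                 ∎
      where open ≡-Reasoning
    heavier : weightBelow q (support a) (flat a) ≤ weightBelow q ys (flat a)
    heavier = to (dominates-expVec⇔ a ys) (proj₁ (to (slide≡1⇔ a _) slide≡1)) (<⇒≤ (<1+K⇒<n q<1+K))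

  dominates⇒support∈incs : ∀ {b} → Dominates b a → flat b ≡ flat a →
                           support b ∈ incs (length (flat a)) (suc K)
  dominates⇒support∈incs {b} dom flat≡ = ∈-incs⁺ len (support-increasing b)
    (sum≤weightBelow⇒all< (support b) (flat a) (flat-positive a) len (begin
      sum (flat a)                             ≡⟨ weightBelow-all< (support a) (flat a) <1+K (length-support a) ⟨
      weightBelow (suc K) (support a) (flat a) ≤⟨ to (dominates-expVec⇔ a (support b)) dom′ K<n ⟩
      weightBelow (suc K) (support b) (flat a) ∎))
    where
    open ≤-Reasoning
    len : length (support b) ≡ length (flat a)
    len = trans (length-support b) (cong length flat≡)
    dom′ : Dominates (expVec (support b) (flat a)) a
    dom′ = subst (λ α → Dominates (expVec (support b) α) a) flat≡
             (subst (λ v → Dominates v a) (sym (expVec-support b)) dom)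

  convex⇒slide≡monoQSym : Convex (support a) → ∀ b → slide a b ≡ monoQSym (suc K) (flat a) b
  convex⇒slide≡monoQSym cvx b with dominates? b a ×-dec ListP.≡-dec _≟_ (flat b) (flat a)
  ... | no ¬dom =
    trans (slide≡0 a b ¬dom)
      (cong ℤ.+_ (sym (length-filter-none (expVec≟ b) (incs (length (flat a)) (suc K)) missing)))
    where
    missing : ∀ {ys} → ys ∈ incs (length (flat a)) (suc K) → expVec ys (flat a) ≢ b
    missing ys∈ e = ¬dom (to (slide≡1⇔ a b) (subst (λ v → slide a v ≡ ℤ.+ 1) e (convex⇒slide≡1 cvx ys∈)))
  ... | yes (dom , flat≡) =
    trans (from (slide≡1⇔ a b) (dom , flat≡)) (cong ℤ.+_ (sym (length-filter-unique (expVec≟ b)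
      (incs (length (flat a)) (suc K)) (incs-unique (length (flat a)) (suc K))
      (dominates⇒support∈incs dom flat≡) (subst (λ α → expVec (support b) α ≡ b) flat≡ (expVec-support b)) only)))
    where
    only : ∀ {ys} → ys ∈ incs (length (flat a)) (suc K) → expVec ys (flat a) ≡ b → ys ≡ support b
    only ys∈ e with ∈-incs⁻ ys∈
    ... | len , inc , ys<1+K =
      trans (sym (support-expVec inc (All.map <1+K⇒<n ys<1+K) (flat-positive a) len)) (cong support e)

lemma3p4 : (n : ℕ) (a : WeakComp n) (k : Fin n) →
    lookup a k ≢ 0 → (∀ (j : Fin n) → toℕ k < toℕ j → lookup a j ≡ 0) →
    (QuasiSymIn (suc (toℕ k)) (slide a) ⇔ QuasiFlat a)
    × (QuasiFlat a → ∀ (b : WeakComp n) → slide a b ≡ monoQSym (suc (toℕ k)) (flat a) b)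
lemma3p4 n a k ak≢0 after =
  mk⇔ (from (quasiFlat⇔convex a) ∘ quasiSym⇒convex a K∈ ≤K)
      (convex⇒quasiSym a K∈ ≤K ∘ to (quasiFlat⇔convex a)) ,
  convex⇒slide≡monoQSym a K∈ ≤K ∘ to (quasiFlat⇔convex a)
  where
  K∈ : toℕ k ∈ support a
  K∈ = to (lookup≢0⇔∈support a k) ak≢0
  ≤K : All (_≤ toℕ k) (support a)
  ≤K = support-≤ a k after
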